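{- Let $q=p^r$ be a prime power with $p$ prime. Then the triangle rank of $D_{\mathbb{Z}/q\mathbb{Z}}$ over $\mathbb{F}_p$ is at most $q$.
   Context: $D_{\mathbb{Z}/q\mathbb{Z}}:(\mathbb{Z}/q\mathbb{Z})^3\to\mathbb{F}_p$ is given by $D(x,y,z)=1$ if $x+y+z=0$ in $\mathbb{Z}/q\mathbb{Z}$ and $0$ otherwise. The triangle rank of a function $F:X\times Y\times Z\to\mathbb{F}$ is the least $k$ for which there exist functions $f_a:X\to\mathbb{F}$, $g_b:Y\to\mathbb{F}$, $h_c:Z\to\mathbb{F}$ for $a,b,c\in\{0,\dots,k-1\}$ and coefficients $r_{a,b,c}\in\mathbb{F}$ such that $F(x,y,z)=\sum_{a+b+c<k}r_{a,b,c}f_a(x)g_b(y)h_c(z)$. -}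

module Defs where

open import Data.Nat as ℕ using (ℕ; zero; suc; _<_)
open import Data.Nat.Divisibility as ℕD using ()
open import Data.Fin using (Fin; toℕ) renaming (zero to fz; suc to fs)
open import Data.Integer as ℤ using (ℤ; +_; _-_)
open import Data.Integer.Divisibility using (_∣_)
open import Relation.Nullary using (Dec; yes; no)
open import Data.Nat.Properties using (_<?_)

∑ : (n : ℕ) → (Fin n → ℤ) → ℤ
∑ zero    f = + 0
∑ (suc n) f = f fz ℤ.+ ∑ n (λ i → f (fs i))

𝔽 : ℕ → Set
𝔽 p = Fin p

⟦_⟧ : ∀ {p} → 𝔽 p → ℤ
⟦ a ⟧ = + toℕ a

_≡[mod_]_ : ℤ → ℕ → ℤ → Set
a ≡[mod p ] b = (+ p) ∣ (a - b)

-- Z/qZ is represented by Fin q (x+y+z=0 in Z/qZ iff q ∣ x+y+z).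
-- D_{Z/qZ} : (Z/qZ)^3 → 𝔽_p, as an integer (0 or 1) to be read in 𝔽_p.
D : (q : ℕ) → Fin q → Fin q → Fin q → ℤ
D q x y z with ℕD._∣?_ q (toℕ x ℕ.+ toℕ y ℕ.+ toℕ z)
... | yes _ = + 1
... | no  _ = + 0

[_+_+_<_] : ℕ → ℕ → ℕ → ℕ → ℤ
[ a + b + c < k ] with (a ℕ.+ b ℕ.+ c) <? k
... | yes _ = + 1
... | no  _ = + 0

-- A triangle decomposition of F : X × Y × Z → 𝔽_p (F given by integer
-- representatives, read modulo p) with parameter k:
-- functions f_a, g_b, h_c (a,b,c < k) and coefficients r_{a,b,c} with
-- F(x,y,z) = ∑_{a+b+c<k} r_{a,b,c} f_a(x) g_b(y) h_c(z)  in 𝔽_p.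
TriangleDecomp : (p : ℕ) {X Y Z : Set} → (X → Y → Z → ℤ) → ℕ → Set
TriangleDecomp p {X} {Y} {Z} F k =
  Σ' (Fin k → X → 𝔽 p) λ f →
  Σ' (Fin k → Y → 𝔽 p) λ g →
  Σ' (Fin k → Z → 𝔽 p) λ h →
  Σ' (Fin k → Fin k → Fin k → 𝔽 p) λ r →
  ∀ x y z →
    F x y z ≡[mod p ]
      ∑ k (λ a → ∑ k (λ b → ∑ k (λ c →
        [ toℕ a + toℕ b + toℕ c < k ] ℤ.* ⟦ r a b c ⟧ ℤ.*
        ⟦ f a x ⟧ ℤ.* ⟦ g b y ⟧ ℤ.* ⟦ h c z ⟧)))
  where open import Data.Product using () renaming (Σ to Σ')

TriangleRank≤ : (p : ℕ) {X Y Z : Set} → (X → Y → Z → ℤ) → ℕ → Set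
TriangleRank≤ p F m = Σ ℕ λ k → (k ℕ.≤ m) × TriangleDecomp p F k
  where open import Data.Product using (Σ; _×_)

-- Over 𝔽_p, with q = p ^ r, the indicator of q ∣ n is the alternating sum ∑_{j<q} (-1)^j C(n,j).
-- Indeed p divides C(q,j) for 0 < j < q, so by Pascal's rule every C(n,j) with j < q is
-- q-periodic in n modulo p; and for n < q the sum is (1 - 1)^n. Taking n = x + y + z and
-- expanding C(x + y + z, j) by Vandermonde's identity gives
--   D(x,y,z) = ∑_{a+b+c<q} (-1)^(a+b+c) C(x,a) C(y,b) C(z,c)  in 𝔽_p,
-- a triangle decomposition with f_a = g_a = h_a = C(-, a).
module Submission where

open import Defs
open import Data.Fin using (Fin; toℕ; fromℕ<)
open import Data.Fin.Properties using (toℕ-fromℕ<)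
open import Data.Integer as ℤ using (ℤ; +_; -_; _+_; _*_; _-_; -1ℤ)
open import Data.Integer.DivMod using (_%ℕ_; _/ℕ_; n%ℕd<d; a≡a%ℕn+[a/ℕn]*n)
import Data.Integer.Divisibility.Signed as Signed
import Data.Integer.Properties as ℤP
open import Data.Integer.Tactic.RingSolver using (solve-∀)
open import Data.Nat as ℕ using (ℕ; zero; suc; NonZero; _<_; _≤_; _^_; z<s; s<s)
open import Data.Nat.Combinatorics using (_C_; k>n⇒nCk≡0; nC1≡n; nCk+nC[k+1]≡[n+1]C[k+1])
import Data.Nat.Divisibility as ℕD
open import Data.Nat.DivMod using (_%_; _/_; m≡m%n+[m/n]*n; m%n<n)
open import Data.Nat.Primality using (Prime; prime⇒nonZero; euclidsLemma)
open import Data.Nat.Properties as ℕP using (_<?_)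
import Data.Nat.Tactic.RingSolver as ℕRing
open import Data.Product using (_,_)
open import Data.Sum using (inj₁; inj₂)
open import Function using (_∘_)
open import Relation.Binary.Bundles using (Setoid)
open import Relation.Binary.PropositionalEquality
  using (_≡_; refl; sym; trans; cong; cong₂; subst; module ≡-Reasoning)
import Relation.Binary.Reasoning.Setoid as SetoidReasoning
open import Relation.Nullary using (¬_; yes; no; contradiction)

-- Sums over initial segments of ℕ

∑< : ℕ → (ℕ → ℤ) → ℤ
∑< n f = ∑ n (f ∘ toℕ)

syntax ∑< n (λ i → e) = ∑[ i < n ] e

∑<-cong : ∀ n {f g : ℕ → ℤ} → (∀ i → i < n → f i ≡ g i) → ∑< n f ≡ ∑< n g
∑<-cong zero    eq = refl
∑<-cong (suc n) eq = cong₂ _+_ (eq 0 z<s) (∑<-cong n (λ i i<n → eq (suc i) (s<s i<n)))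

∑<-zero : ∀ n {f : ℕ → ℤ} → (∀ i → i < n → f i ≡ + 0) → ∑< n f ≡ + 0
∑<-zero zero    eq = refl
∑<-zero (suc n) eq = cong₂ _+_ (eq 0 z<s) (∑<-zero n (λ i i<n → eq (suc i) (s<s i<n)))

∑<-distrib-+ : ∀ n (f g : ℕ → ℤ) → ∑[ i < n ] (f i + g i) ≡ ∑< n f + ∑< n g
∑<-distrib-+ zero    f g = refl
∑<-distrib-+ (suc n) f g =
  trans (cong (_+_ (f 0 + g 0)) (∑<-distrib-+ n (f ∘ suc) (g ∘ suc))) (medial (f 0) (g 0) _ _)
  where
  medial : ∀ a b c d → a + b + (c + d) ≡ a + c + (b + d)
  medial = solve-∀

∑<-distribˡ-* : ∀ n c (f : ℕ → ℤ) → ∑[ i < n ] (c * f i) ≡ c * ∑< n f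
∑<-distribˡ-* zero    c f = sym (ℤP.*-zeroʳ c)
∑<-distribˡ-* (suc n) c f =
  trans (cong (_+_ (c * f 0)) (∑<-distribˡ-* n c (f ∘ suc))) (sym (ℤP.*-distribˡ-+ c (f 0) _))

∑<-snoc : ∀ n (f : ℕ → ℤ) → ∑< (suc n) f ≡ ∑< n f + f n
∑<-snoc zero    f = trans (ℤP.+-identityʳ (f 0)) (sym (ℤP.+-identityˡ (f 0)))
∑<-snoc (suc n) f = trans (cong (_+_ (f 0)) (∑<-snoc n (f ∘ suc))) (sym (ℤP.+-assoc (f 0) _ _))

module Congruence (p : ℕ) where

  -- A record rather than _≡[mod p ]_ itself: that one is defined through ∣_∣, which keeps
  -- Agda from inferring the two sides of a congruence.
  infix 4 _≋_
  record _≋_ (a b : ℤ) : Set where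
    constructor mod-by
    field
      p∣a-b : (+ p) Signed.∣ (a - b)

  ≋⇒≡[mod] : ∀ {a b} → a ≋ b → a ≡[mod p ] b
  ≋⇒≡[mod] {a} {b} (mod-by p∣a-b) = Signed.∣⇒∣ᵤ {+ p} {a - b} p∣a-b

  ≋-reflexive : ∀ {a b} → a ≡ b → a ≋ b
  ≋-reflexive {a} refl = mod-by (Signed.divides (+ 0) (ℤP.+-inverseʳ a))

  ≋-sym : ∀ {a b} → a ≋ b → b ≋ a
  ≋-sym {a} {b} (mod-by p∣a-b) = mod-by (subst (+ p Signed.∣_) (negate a b) (Signed.∣m⇒∣-m p∣a-b))
    where
    negate : ∀ a b → - (a - b) ≡ b - a
    negate = solve-∀

  ≋-trans : ∀ {a b c} → a ≋ b → b ≋ c → a ≋ c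
  ≋-trans {a} {b} {c} (mod-by p∣a-b) (mod-by p∣b-c) =
    mod-by (subst (+ p Signed.∣_) (telescope a b c) (Signed.∣m∣n⇒∣m+n p∣a-b p∣b-c))
    where
    telescope : ∀ a b c → (a - b) + (b - c) ≡ a - c
    telescope = solve-∀

  ≋-setoid : Setoid _ _
  ≋-setoid = record
    { Carrier       = ℤ
    ; _≈_           = _≋_
    ; isEquivalence = record { refl = ≋-reflexive refl ; sym = ≋-sym ; trans = ≋-trans }
    }

  +-cong-≋ : ∀ {a b c d} → a ≋ b → c ≋ d → a + c ≋ b + d
  +-cong-≋ {a} {b} {c} {d} (mod-by p∣a-b) (mod-by p∣c-d) =
    mod-by (subst (+ p Signed.∣_) (regroup a b c d) (Signed.∣m∣n⇒∣m+n p∣a-b p∣c-d))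
    where
    regroup : ∀ a b c d → (a - b) + (c - d) ≡ (a + c) - (b + d)
    regroup = solve-∀

  *-cong-≋ : ∀ {a b c d} → a ≋ b → c ≋ d → a * c ≋ b * d
  *-cong-≋ {a} {b} {c} {d} (mod-by p∣a-b) (mod-by p∣c-d) = mod-by (subst (+ p Signed.∣_) (regroup a b c d)
    (Signed.∣m∣n⇒∣m+n (Signed.∣m⇒∣m*n c p∣a-b) (Signed.∣n⇒∣m*n b p∣c-d)))
    where
    regroup : ∀ a b c d → (a - b) * c + b * (c - d) ≡ a * c - b * d
    regroup = solve-∀

  ∣⇒≋0 : ∀ {n} → p ℕD.∣ n → + n ≋ + 0
  ∣⇒≋0 {n} (ℕD.divides t eq) =
    mod-by (Signed.divides (+ t) (trans (ℤP.+-identityʳ (+ n)) (trans (cong +_ eq) (ℤP.pos-* t p))))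

  ∑<-cong-≋ : ∀ n {f g : ℕ → ℤ} → (∀ i → i < n → f i ≋ g i) → ∑< n f ≋ ∑< n g
  ∑<-cong-≋ zero    eq = ≋-reflexive refl
  ∑<-cong-≋ (suc n) eq = +-cong-≋ (eq 0 z<s) (∑<-cong-≋ n (λ i i<n → eq (suc i) (s<s i<n)))

  ∑<³-cong-≋ : ∀ n (F G : ℕ → ℕ → ℕ → ℤ) → (∀ a b c → F a b c ≋ G a b c) →
    ∑[ a < n ] ∑[ b < n ] ∑[ c < n ] F a b c ≋ ∑[ a < n ] ∑[ b < n ] ∑[ c < n ] G a b c
  ∑<³-cong-≋ n F G F≋G =
    ∑<-cong-≋ n λ a _ → ∑<-cong-≋ n λ b _ → ∑<-cong-≋ n {F a b} {G a b} λ c _ → F≋G a b c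

  module _ .{{_ : NonZero p}} where

    reduce : ℤ → 𝔽 p
    reduce i = fromℕ< (n%ℕd<d i p)

    ⟦reduce⟧ : ∀ i → ⟦ reduce i ⟧ ≋ i
    ⟦reduce⟧ i = mod-by (Signed.divides (- (i /ℕ p)) (begin
      ⟦ reduce i ⟧ - i
        ≡⟨ cong₂ (λ r j → + r - j) (toℕ-fromℕ< (n%ℕd<d i p)) (a≡a%ℕn+[a/ℕn]*n i p) ⟩
      + (i %ℕ p) - (+ (i %ℕ p) + (i /ℕ p) * + p)
        ≡⟨ cancel (+ (i %ℕ p)) (i /ℕ p) (+ p) ⟩
      - (i /ℕ p) * + p ∎))
      where
      open ≡-Reasoning
      cancel : ∀ r t q → r - (r + t * q) ≡ - t * q
      cancel = solve-∀

-- Binomial coefficients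

pascal : ∀ n k → + (suc n C suc k) ≡ + (n C k) + + (n C suc k)
pascal n k = trans (cong +_ (sym (nCk+nC[k+1]≡[n+1]C[k+1] n k))) (ℤP.pos-+ (n C k) (n C suc k))

C-absorption : ∀ n k → suc k ℕ.* (suc n C suc k) ≡ suc n ℕ.* (n C k)
C-absorption zero    zero    = refl
C-absorption zero    (suc k) = begin
  suc (suc k) ℕ.* (1 C suc (suc k))   ≡⟨ cong (suc (suc k) ℕ.*_) (k>n⇒nCk≡0 {1} {suc (suc k)} (s<s z<s)) ⟩
  suc (suc k) ℕ.* 0                   ≡⟨ ℕP.*-zeroʳ (suc (suc k)) ⟩
  0                                   ≡⟨ cong (1 ℕ.*_) (k>n⇒nCk≡0 {0} {suc k} z<s) ⟨
  1 ℕ.* (0 C suc k)                   ∎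
  where open ≡-Reasoning
C-absorption (suc n) zero    =
  trans (ℕP.*-identityˡ _) (trans (nC1≡n (suc (suc n))) (sym (ℕP.*-identityʳ (suc (suc n)))))
C-absorption (suc n) (suc k) = begin
  (2 ℕ.+ k) ℕ.* (suc (suc n) C suc (suc k))           ≡⟨ cong ((2 ℕ.+ k) ℕ.*_) (nCk+nC[k+1]≡[n+1]C[k+1] (suc n) (suc k)) ⟨
  (2 ℕ.+ k) ℕ.* (X ℕ.+ Y)                             ≡⟨ expand k X Y ⟩
  (1 ℕ.+ k) ℕ.* X ℕ.+ X ℕ.+ (2 ℕ.+ k) ℕ.* Y           ≡⟨ cong₂ (λ u v → u ℕ.+ X ℕ.+ v) (C-absorption n k) (C-absorption n (suc k)) ⟩
  (1 ℕ.+ n) ℕ.* a ℕ.+ X ℕ.+ (1 ℕ.+ n) ℕ.* b           ≡⟨ cong (λ t → (1 ℕ.+ n) ℕ.* a ℕ.+ t ℕ.+ (1 ℕ.+ n) ℕ.* b) (nCk+nC[k+1]≡[n+1]C[k+1] n k) ⟨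
  (1 ℕ.+ n) ℕ.* a ℕ.+ (a ℕ.+ b) ℕ.+ (1 ℕ.+ n) ℕ.* b   ≡⟨ collect n a b ⟩
  (2 ℕ.+ n) ℕ.* (a ℕ.+ b)                             ≡⟨ cong ((2 ℕ.+ n) ℕ.*_) (nCk+nC[k+1]≡[n+1]C[k+1] n k) ⟩
  (2 ℕ.+ n) ℕ.* X                                     ∎
  where
  open ≡-Reasoning
  X = suc n C suc k
  Y = suc n C suc (suc k)
  a = n C k
  b = n C suc k
  expand : ∀ k X Y → (2 ℕ.+ k) ℕ.* (X ℕ.+ Y) ≡ (1 ℕ.+ k) ℕ.* X ℕ.+ X ℕ.+ (2 ℕ.+ k) ℕ.* Y
  expand = ℕRing.solve-∀
  collect : ∀ n a b → (1 ℕ.+ n) ℕ.* a ℕ.+ (a ℕ.+ b) ℕ.+ (1 ℕ.+ n) ℕ.* b ≡ (2 ℕ.+ n) ℕ.* (a ℕ.+ b)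
  collect = ℕRing.solve-∀

n∣[1+k]*nC[1+k] : ∀ n k → n ℕD.∣ suc k ℕ.* (n C suc k)
n∣[1+k]*nC[1+k] zero    k = ℕD.divides 0 (ℕP.*-zeroʳ (suc k))
n∣[1+k]*nC[1+k] (suc n) k = ℕD.divides (n C k) (trans (C-absorption n k) (ℕP.*-comm (suc n) (n C k)))

module _ {p : ℕ} (p-prime : Prime p) where

  private instance
    p≢0 : NonZero p
    p≢0 = prime⇒nonZero p-prime

  p^r∣j*m⇒p∣m : ∀ r j m → 0 < j → j < p ^ r → p ^ r ℕD.∣ j ℕ.* m → p ℕD.∣ m
  p^r∣j*m⇒p∣m zero    j m 0<j j<1 _ = contradiction j<1 (ℕP.≤⇒≯ 0<j)
  p^r∣j*m⇒p∣m (suc r) j m 0<j j<p^[1+r] p^[1+r]∣jm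
    with euclidsLemma j m p-prime (ℕD.∣-trans (ℕD.m∣m*n (p ^ r)) p^[1+r]∣jm)
  ... | inj₂ p∣m                       = p∣m
  ... | inj₁ (ℕD.divides zero refl)    = contradiction 0<j (ℕP.<-irrefl refl)
  ... | inj₁ (ℕD.divides (suc d) refl) = p^r∣j*m⇒p∣m r (suc d) m z<s d<p^r
    (ℕD.*-cancelˡ-∣ p (subst (p ℕ.* p ^ r ℕD.∣_) (regroup (suc d) p m) p^[1+r]∣jm))
    where
    d<p^r : suc d < p ^ r
    d<p^r = ℕP.*-cancelʳ-< p (suc d) (p ^ r) (subst (suc d ℕ.* p <_) (ℕP.*-comm p (p ^ r)) j<p^[1+r])
    regroup : ∀ d p m → d ℕ.* p ℕ.* m ≡ p ℕ.* (d ℕ.* m)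
    regroup = ℕRing.solve-∀

  p∣p^rCj : ∀ r j → 0 < j → j < p ^ r → p ℕD.∣ (p ^ r) C j
  p∣p^rCj r (suc k) 0<j j<p^r = p^r∣j*m⇒p∣m r (suc k) _ 0<j j<p^r (n∣[1+k]*nC[1+k] (p ^ r) k)

-- Binomial sums ∑_{a<K} C(x,a) φ(a)

binomialSum : ℕ → ℕ → (ℕ → ℤ) → ℤ
binomialSum K x φ = ∑[ a < K ] (+ (x C a) * φ a)

binomialSum-cong : ∀ K x {φ ψ : ℕ → ℤ} → (∀ a → a < K → φ a ≡ ψ a) → binomialSum K x φ ≡ binomialSum K x ψ
binomialSum-cong K x eq = ∑<-cong K (λ a a<K → cong (+ (x C a) *_) (eq a a<K))

binomialSum-zeroˡ : ∀ K .{{_ : NonZero K}} (φ : ℕ → ℤ) → binomialSum K 0 φ ≡ φ 0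
binomialSum-zeroˡ (suc K) φ = begin
  + 1 * φ 0 + ∑[ a < K ] (+ (0 C suc a) * φ (suc a))  ≡⟨ cong₂ _+_ (ℤP.*-identityˡ (φ 0)) (∑<-zero K vanish) ⟩
  φ 0 + + 0                                           ≡⟨ ℤP.+-identityʳ (φ 0) ⟩
  φ 0                                                 ∎
  where
  open ≡-Reasoning
  vanish : ∀ a → a < K → + (0 C suc a) * φ (suc a) ≡ + 0
  vanish a _ = trans (cong (λ c → + c * φ (suc a)) (k>n⇒nCk≡0 {0} {suc a} z<s)) (ℤP.*-zeroˡ (φ (suc a)))

binomialSum-suc : ∀ K x (φ : ℕ → ℤ) →
  binomialSum (suc K) (suc x) φ ≡ binomialSum (suc K) x φ + binomialSum K x (φ ∘ suc)
binomialSum-suc K x φ = begin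
  φ₀ + ∑[ a < K ] (+ (suc x C suc a) * φ (suc a))
    ≡⟨ cong (_+_ φ₀) (∑<-cong K (λ a _ → split a)) ⟩
  φ₀ + ∑[ a < K ] (+ (x C a) * φ (suc a) + + (x C suc a) * φ (suc a))
    ≡⟨ cong (_+_ φ₀) (∑<-distrib-+ K (λ a → + (x C a) * φ (suc a)) (λ a → + (x C suc a) * φ (suc a))) ⟩
  φ₀ + (binomialSum K x (φ ∘ suc) + ∑[ a < K ] (+ (x C suc a) * φ (suc a)))
    ≡⟨ rotate φ₀ _ _ ⟩
  binomialSum (suc K) x φ + binomialSum K x (φ ∘ suc) ∎
  where
  open ≡-Reasoning
  φ₀ = + 1 * φ 0
  split : ∀ a → + (suc x C suc a) * φ (suc a) ≡ + (x C a) * φ (suc a) + + (x C suc a) * φ (suc a)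
  split a = trans (cong (_* φ (suc a)) (pascal x a)) (ℤP.*-distribʳ-+ (φ (suc a)) (+ (x C a)) (+ (x C suc a)))
  rotate : ∀ u v w → u + (v + w) ≡ u + w + v
  rotate = solve-∀

binomialSum-shift : ∀ K x (φ : ℕ → ℤ) → φ K ≡ + 0 →
  binomialSum K (suc x) φ ≡ binomialSum K x φ + binomialSum K x (φ ∘ suc)
binomialSum-shift zero    x φ _    = refl
binomialSum-shift (suc K) x φ φK≡0 = begin
  binomialSum (suc K) (suc x) φ                               ≡⟨ binomialSum-suc K x φ ⟩
  binomialSum (suc K) x φ + binomialSum K x (φ ∘ suc)         ≡⟨ cong (_+_ (binomialSum (suc K) x φ)) last-term ⟨
  binomialSum (suc K) x φ + binomialSum (suc K) x (φ ∘ suc)   ∎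
  where
  open ≡-Reasoning
  last-term : binomialSum (suc K) x (φ ∘ suc) ≡ binomialSum K x (φ ∘ suc)
  last-term = begin
    binomialSum (suc K) x (φ ∘ suc)                     ≡⟨ ∑<-snoc K (λ a → + (x C a) * φ (suc a)) ⟩
    binomialSum K x (φ ∘ suc) + + (x C K) * φ (suc K)   ≡⟨ cong (λ t → binomialSum K x (φ ∘ suc) + + (x C K) * t) φK≡0 ⟩
    binomialSum K x (φ ∘ suc) + + (x C K) * + 0         ≡⟨ cong (_+_ (binomialSum K x (φ ∘ suc))) (ℤP.*-zeroʳ (+ (x C K))) ⟩
    binomialSum K x (φ ∘ suc) + + 0                     ≡⟨ ℤP.+-identityʳ _ ⟩
    binomialSum K x (φ ∘ suc)                           ∎

VanishesFrom : ℕ → (ℕ → ℤ) → Set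
VanishesFrom K φ = ∀ j → K ≤ j → φ j ≡ + 0

binomialSum-vanishesFrom : ∀ K y {φ : ℕ → ℤ} → VanishesFrom K φ →
  VanishesFrom K (λ m → binomialSum K y (λ b → φ (m ℕ.+ b)))
binomialSum-vanishesFrom K y {φ} φ-vanishes m K≤m = ∑<-zero K (λ b _ →
  trans (cong (+ (y C b) *_) (φ-vanishes (m ℕ.+ b) (ℕP.≤-trans K≤m (ℕP.m≤m+n m b)))) (ℤP.*-zeroʳ (+ (y C b))))

binomialSum-vandermonde : ∀ K x y {φ : ℕ → ℤ} → VanishesFrom K φ →
  binomialSum K x (λ a → binomialSum K y (λ b → φ (a ℕ.+ b))) ≡ binomialSum K (x ℕ.+ y) φ
binomialSum-vandermonde zero    zero    y     φ-vanishes = refl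
binomialSum-vandermonde (suc K) zero    y {φ} φ-vanishes =
  binomialSum-zeroˡ (suc K) (λ a → binomialSum (suc K) y (λ b → φ (a ℕ.+ b)))
binomialSum-vandermonde K       (suc x) y {φ} φ-vanishes = begin
  binomialSum K (suc x) Φ
    ≡⟨ binomialSum-shift K x Φ (binomialSum-vanishesFrom K y φ-vanishes K ℕP.≤-refl) ⟩
  binomialSum K x Φ + binomialSum K x (Φ ∘ suc)
    ≡⟨ cong₂ _+_ (binomialSum-vandermonde K x y φ-vanishes)
                 (binomialSum-vandermonde K x y (λ j K≤j → φ-vanishes (suc j) (ℕP.m≤n⇒m≤1+n K≤j))) ⟩
  binomialSum K (x ℕ.+ y) φ + binomialSum K (x ℕ.+ y) (φ ∘ suc)
    ≡⟨ binomialSum-shift K (x ℕ.+ y) φ (φ-vanishes K ℕP.≤-refl) ⟨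
  binomialSum K (suc x ℕ.+ y) φ ∎
  where
  open ≡-Reasoning
  Φ : ℕ → ℤ
  Φ a = binomialSum K y (λ b → φ (a ℕ.+ b))

binomialSum-vandermonde³ : ∀ K x y z {φ : ℕ → ℤ} → VanishesFrom K φ →
  binomialSum K x (λ a → binomialSum K y (λ b → binomialSum K z (λ c → φ (a ℕ.+ b ℕ.+ c))))
    ≡ binomialSum K (x ℕ.+ y ℕ.+ z) φ
binomialSum-vandermonde³ K x y z φ-vanishes = trans
  (binomialSum-vandermonde K x y (binomialSum-vanishesFrom K z φ-vanishes))
  (binomialSum-vandermonde K (x ℕ.+ y) z φ-vanishes)

binomialSum³-expand : ∀ K x y z (ψ : ℕ → ℕ → ℕ → ℤ) →
  binomialSum K x (λ a → binomialSum K y (λ b → binomialSum K z (λ c → ψ a b c)))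
    ≡ ∑[ a < K ] ∑[ b < K ] ∑[ c < K ] (ψ a b c * + (x C a) * + (y C b) * + (z C c))
binomialSum³-expand K x y z ψ = ∑<-cong K λ a _ → begin
  + (x C a) * ∑[ b < K ] (+ (y C b) * binomialSum K z (ψ a b))
    ≡⟨ ∑<-distribˡ-* K (+ (x C a)) (λ b → + (y C b) * binomialSum K z (ψ a b)) ⟨
  ∑[ b < K ] (+ (x C a) * (+ (y C b) * binomialSum K z (ψ a b)))
    ≡⟨ ∑<-cong K (λ b _ → begin
         + (x C a) * (+ (y C b) * binomialSum K z (ψ a b))
           ≡⟨ ℤP.*-assoc (+ (x C a)) (+ (y C b)) _ ⟨
         + (x C a) * + (y C b) * binomialSum K z (ψ a b)
           ≡⟨ ∑<-distribˡ-* K (+ (x C a) * + (y C b)) (λ c → + (z C c) * ψ a b c) ⟨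
         ∑[ c < K ] (+ (x C a) * + (y C b) * (+ (z C c) * ψ a b c))
           ≡⟨ ∑<-cong K (λ c _ → reorder (+ (x C a)) (+ (y C b)) (+ (z C c)) (ψ a b c)) ⟩
         ∑[ c < K ] (ψ a b c * + (x C a) * + (y C b) * + (z C c)) ∎) ⟩
  ∑[ b < K ] ∑[ c < K ] (ψ a b c * + (x C a) * + (y C b) * + (z C c)) ∎
  where
  open ≡-Reasoning
  reorder : ∀ u v w t → u * v * (w * t) ≡ t * u * v * w
  reorder = solve-∀

alternatingSum : ℕ → ℕ → ℤ
alternatingSum K n = binomialSum K n (-1ℤ ℤ.^_)

alternatingSum-suc : ∀ k u → alternatingSum (suc k) (suc u) ≡ alternatingSum (suc k) u - alternatingSum k u
alternatingSum-suc k u = begin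
  alternatingSum (suc k) (suc u)                                      ≡⟨ binomialSum-suc k u (-1ℤ ℤ.^_) ⟩
  alternatingSum (suc k) u + binomialSum k u (λ j → -1ℤ * -1ℤ ℤ.^ j)  ≡⟨ cong (_+_ (alternatingSum (suc k) u)) negate ⟩
  alternatingSum (suc k) u - alternatingSum k u                       ∎
  where
  open ≡-Reasoning
  swap : ∀ c m s → c * (m * s) ≡ m * (c * s)
  swap = solve-∀
  negate : binomialSum k u (λ j → -1ℤ * -1ℤ ℤ.^ j) ≡ - alternatingSum k u
  negate = begin
    ∑[ j < k ] (+ (u C j) * (-1ℤ * -1ℤ ℤ.^ j))  ≡⟨ ∑<-cong k (λ j _ → swap (+ (u C j)) -1ℤ (-1ℤ ℤ.^ j)) ⟩
    ∑[ j < k ] (-1ℤ * (+ (u C j) * -1ℤ ℤ.^ j))  ≡⟨ ∑<-distribˡ-* k -1ℤ (λ j → + (u C j) * -1ℤ ℤ.^ j) ⟩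
    -1ℤ * alternatingSum k u                    ≡⟨ ℤP.-1*i≡-i _ ⟩
    - alternatingSum k u                        ∎

alternatingSum-vanishes : ∀ u K → suc u < K → alternatingSum K (suc u) ≡ + 0
alternatingSum-vanishes zero    (suc zero)    (s<s ())
alternatingSum-vanishes zero    (suc (suc k)) _ = begin
  alternatingSum (suc (suc k)) 1                                ≡⟨ alternatingSum-suc (suc k) 0 ⟩
  alternatingSum (suc (suc k)) 0 - alternatingSum (suc k) 0     ≡⟨ cong₂ _-_ (binomialSum-zeroˡ (suc (suc k)) (-1ℤ ℤ.^_))
                                                                             (binomialSum-zeroˡ (suc k) (-1ℤ ℤ.^_)) ⟩
  + 1 - + 1                                                     ∎
  where open ≡-Reasoning
alternatingSum-vanishes (suc u) (suc k) (s<s u<k) = begin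
  alternatingSum (suc k) (suc (suc u))                          ≡⟨ alternatingSum-suc k (suc u) ⟩
  alternatingSum (suc k) (suc u) - alternatingSum k (suc u)     ≡⟨ cong₂ _-_ (alternatingSum-vanishes u (suc k) (ℕP.m<n⇒m<1+n u<k))
                                                                             (alternatingSum-vanishes u k u<k) ⟩
  + 0 - + 0                                                     ∎
  where open ≡-Reasoning

-- The triangle decomposition of D

𝟙[_<_] : ℕ → ℕ → ℤ
𝟙[ j < k ] with j <? k
... | yes _ = + 1
... | no  _ = + 0

𝟙-< : ∀ {j k} → j < k → 𝟙[ j < k ] ≡ + 1
𝟙-< {j} {k} j<k with j <? k
... | yes _   = refl
... | no  j≮k = contradiction j<k j≮k

𝟙-≥ : ∀ {j k} → k ≤ j → 𝟙[ j < k ] ≡ + 0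
𝟙-≥ {j} {k} k≤j with j <? k
... | yes j<k = contradiction j<k (ℕP.≤⇒≯ k≤j)
... | no  _   = refl

[+<]≡𝟙 : ∀ a b c k → [ a + b + c < k ] ≡ 𝟙[ a ℕ.+ b ℕ.+ c < k ]
[+<]≡𝟙 a b c k with (a ℕ.+ b ℕ.+ c) <? k
... | yes _ = refl
... | no  _ = refl

module _ (p q : ℕ) (p∣qCj : ∀ j → 0 < j → j < q → p ℕD.∣ q C j) where

  open Congruence p

  C-periodic : ∀ m j → j < q → + ((m ℕ.+ q) C j) ≋ + (m C j)
  C-periodic zero    zero    _   = ≋-reflexive refl
  C-periodic zero    (suc j) j<q =
    ≋-trans (∣⇒≋0 (p∣qCj (suc j) z<s j<q)) (≋-reflexive (cong +_ (sym (k>n⇒nCk≡0 {0} {suc j} z<s))))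
  C-periodic (suc m) zero    _   = ≋-reflexive refl
  C-periodic (suc m) (suc j) j<q = begin
    + (suc (m ℕ.+ q) C suc j)                   ≡⟨ pascal (m ℕ.+ q) j ⟩
    + ((m ℕ.+ q) C j) + + ((m ℕ.+ q) C suc j)   ≈⟨ +-cong-≋ (C-periodic m j (ℕP.<-trans (ℕP.n<1+n j) j<q))
                                                            (C-periodic m (suc j) j<q) ⟩
    + (m C j) + + (m C suc j)                   ≡⟨ pascal m j ⟨
    + (suc m C suc j)                           ∎
    where open SetoidReasoning ≋-setoid

  C-periodic-* : ∀ t u j → j < q → + ((u ℕ.+ t ℕ.* q) C j) ≋ + (u C j)
  C-periodic-* zero    u j j<q = ≋-reflexive (cong (λ m → + (m C j)) (ℕP.+-identityʳ u))
  C-periodic-* (suc t) u j j<q = begin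
    + ((u ℕ.+ (q ℕ.+ t ℕ.* q)) C j)   ≡⟨ cong (λ m → + (m C j)) (regroup u q (t ℕ.* q)) ⟩
    + ((u ℕ.+ t ℕ.* q ℕ.+ q) C j)     ≈⟨ C-periodic (u ℕ.+ t ℕ.* q) j j<q ⟩
    + ((u ℕ.+ t ℕ.* q) C j)           ≈⟨ C-periodic-* t u j j<q ⟩
    + (u C j)                         ∎
    where
    open SetoidReasoning ≋-setoid
    regroup : ∀ u q s → u ℕ.+ (q ℕ.+ s) ≡ u ℕ.+ s ℕ.+ q
    regroup = ℕRing.solve-∀

  module _ .{{_ : NonZero q}} where

    binomialSum-% : ∀ n φ → binomialSum q n φ ≋ binomialSum q (n % q) φ
    binomialSum-% n φ = ∑<-cong-≋ q {λ a → + (n C a) * φ a} {λ a → + ((n % q) C a) * φ a} λ a a<q →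
      *-cong-≋ (begin
        + (n C a)                           ≡⟨ cong (λ m → + (m C a)) (m≡m%n+[m/n]*n n q) ⟩
        + ((n % q ℕ.+ (n / q) ℕ.* q) C a)   ≈⟨ C-periodic-* (n / q) (n % q) a a<q ⟩
        + ((n % q) C a)                     ∎)
      (≋-reflexive refl)
      where open SetoidReasoning ≋-setoid

    alternatingSum-divisible : ∀ n → q ℕD.∣ n → alternatingSum q n ≋ + 1
    alternatingSum-divisible n q∣n = begin
      alternatingSum q n         ≈⟨ binomialSum-% n (-1ℤ ℤ.^_) ⟩
      alternatingSum q (n % q)   ≡⟨ cong (alternatingSum q) (ℕD.n∣m⇒m%n≡0 n q q∣n) ⟩
      alternatingSum q 0         ≡⟨ binomialSum-zeroˡ q (-1ℤ ℤ.^_) ⟩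
      + 1                        ∎
      where open SetoidReasoning ≋-setoid

    alternatingSum-indivisible : ∀ n → ¬ q ℕD.∣ n → alternatingSum q n ≋ + 0
    alternatingSum-indivisible n q∤n with n % q in n%q≡
    ... | zero  = contradiction (ℕD.m%n≡0⇒n∣m n q n%q≡) q∤n
    ... | suc u = begin
      alternatingSum q n         ≈⟨ binomialSum-% n (-1ℤ ℤ.^_) ⟩
      alternatingSum q (n % q)   ≡⟨ cong (alternatingSum q) n%q≡ ⟩
      alternatingSum q (suc u)   ≡⟨ alternatingSum-vanishes u q (subst (_< q) n%q≡ (m%n<n n q)) ⟩
      + 0                        ∎
      where open SetoidReasoning ≋-setoid

    D≋alternatingSum : ∀ x y z → D q x y z ≋ alternatingSum q (toℕ x ℕ.+ toℕ y ℕ.+ toℕ z)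
    D≋alternatingSum x y z with q ℕD.∣? (toℕ x ℕ.+ toℕ y ℕ.+ toℕ z)
    ... | yes q∣n = ≋-sym (alternatingSum-divisible _ q∣n)
    ... | no  q∤n = ≋-sym (alternatingSum-indivisible _ q∤n)

    truncatedSign : ℕ → ℤ
    truncatedSign j = 𝟙[ j < q ] * -1ℤ ℤ.^ j

    truncatedSign-vanishesFrom : VanishesFrom q truncatedSign
    truncatedSign-vanishesFrom j q≤j = trans (cong (_* -1ℤ ℤ.^ j) (𝟙-≥ q≤j)) (ℤP.*-zeroˡ (-1ℤ ℤ.^ j))

    truncatedSign-< : ∀ j → j < q → -1ℤ ℤ.^ j ≡ truncatedSign j
    truncatedSign-< j j<q = sym (trans (cong (_* -1ℤ ℤ.^ j) (𝟙-< j<q)) (ℤP.*-identityˡ (-1ℤ ℤ.^ j)))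

    triangleRank-D≤ : .{{_ : NonZero p}} → TriangleRank≤ p (D q) q
    triangleRank-D≤ = q , ℕP.≤-refl , f , f , f , r , decomposition
      where
      f : Fin q → Fin q → 𝔽 p
      f a x = reduce (+ (toℕ x C toℕ a))

      r : Fin q → Fin q → Fin q → 𝔽 p
      r a b c = reduce (-1ℤ ℤ.^ (toℕ a ℕ.+ toℕ b ℕ.+ toℕ c))

      decomposition : ∀ x y z → D q x y z ≡[mod p ]
        ∑ q (λ a → ∑ q (λ b → ∑ q (λ c →
          [ toℕ a + toℕ b + toℕ c < q ] * ⟦ r a b c ⟧ * ⟦ f a x ⟧ * ⟦ f b y ⟧ * ⟦ f c z ⟧)))
      decomposition x y z = ≋⇒≡[mod] (begin
        D q x y z
          ≈⟨ D≋alternatingSum x y z ⟩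
        alternatingSum q (X ℕ.+ Y ℕ.+ Z)
          ≡⟨ binomialSum-cong q (X ℕ.+ Y ℕ.+ Z) truncatedSign-< ⟩
        binomialSum q (X ℕ.+ Y ℕ.+ Z) truncatedSign
          ≡⟨ binomialSum-vandermonde³ q X Y Z truncatedSign-vanishesFrom ⟨
        binomialSum q X (λ a → binomialSum q Y (λ b → binomialSum q Z (λ c → truncatedSign (a ℕ.+ b ℕ.+ c))))
          ≡⟨ binomialSum³-expand q X Y Z (λ a b c → truncatedSign (a ℕ.+ b ℕ.+ c)) ⟩
        ∑[ a < q ] ∑[ b < q ] ∑[ c < q ] (truncatedSign (a ℕ.+ b ℕ.+ c) * + (X C a) * + (Y C b) * + (Z C c))
          ≈⟨ ∑<³-cong-≋ q _ _ (λ a b c → ≋-sym (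
               *-cong-≋ (*-cong-≋ (*-cong-≋ (*-cong-≋ (≋-reflexive ([+<]≡𝟙 a b c q))
                 (⟦reduce⟧ (-1ℤ ℤ.^ (a ℕ.+ b ℕ.+ c)))) (⟦reduce⟧ (+ (X C a)))) (⟦reduce⟧ (+ (Y C b))))
                 (⟦reduce⟧ (+ (Z C c))))) ⟩
        ∑[ a < q ] ∑[ b < q ] ∑[ c < q ] ([ a + b + c < q ] * ⟦ reduce (-1ℤ ℤ.^ (a ℕ.+ b ℕ.+ c)) ⟧
          * ⟦ reduce (+ (X C a)) ⟧ * ⟦ reduce (+ (Y C b)) ⟧ * ⟦ reduce (+ (Z C c)) ⟧) ∎)
        where
        open SetoidReasoning ≋-setoid
        X = toℕ x
        Y = toℕ y
        Z = toℕ z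

proposition4p15 : (p r : ℕ) → Prime p →
    TriangleRank≤ p (D (p ^ r)) (p ^ r)
proposition4p15 p r p-prime = triangleRank-D≤ p (p ^ r) (p∣p^rCj p-prime r)
  where
  instance
    p≢0 : NonZero p
    p≢0 = prime⇒nonZero p-prime
    p^r≢0 : NonZero (p ^ r)
    p^r≢0 = ℕP.m^n≢0 p r
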